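{- Let $n,\ell$ be positive integers. For $i=1,\ldots,\ell$, let $\mu_i$ be a positive integer, $k_i=\lfloor \mu_i(n-1)/2\rfloor$, and assume $\mu_iK_n$ admits a 2-factorization of type $\mathcal{T}_i=[T_{i,1},\ldots,T_{i,k_i}]$. Let $\mathcal{O}=\{i:\mu_i(n-1)\text{ is odd}\}$ and let $\mu$ be a positive integer. Then $\mu K_n$ admits a 2-factorization of type $$\bigsqcup_{i=1}^{\ell}[T_{i,1}^{\langle x_i\rangle},\ldots,T_{i,k_i}^{\langle x_i\rangle}]\ \sqcup\ [T_1,\ldots,T_{\lfloor\beta/2\rfloor}]$$ for all $(x_1,\ldots,x_\ell)\in\mathbb{N}^\ell$ with $\sum_{i=1}^\ell x_i\mu_i=\mu$, where $\beta=\sum_{i\in\mathcal{O}}x_i$, and for all admissible bipartite 2-factor types $T_1,\ldots,T_{\lfloor\beta/2\rfloor}$ for $2K_n$.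
   Context: $\mu K_n$: complete multigraph on $n$ vertices with $\mu$ parallel edges between each pair. A 2-factor is a spanning 2-regular subgraph (2-cycles, i.e. pairs of parallel edges, allowed); it has type $[c_1,\ldots,c_t]$ if it is a disjoint union of cycles of lengths $c_1,\ldots,c_t$. A 2-factorization of an $r$-regular graph is a decomposition into $\lfloor r/2\rfloor$ 2-factors, plus a single 1-factor if $r$ is odd; its type is the multiset of the types of its 2-factors. Multiset notation: $[x^{\langle a\rangle}]$ denotes $a$ copies of $x$; $\sqcup$ is multiset union (multiplicities add). A 2-factor type is bipartite if all cycle lengths are even; it is admissible for $\lambda K_n$ iff its entries sum to $n$, all are at least 2, and all are at least 3 when $\lambda=1$. -}

module Defs where

open import Data.Nat using (ℕ; zero; suc; _+_; _*_; _∸_; _/_; _%_; _≤_; _≡ᵇ_)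
open import Data.Bool using (Bool; true; false; if_then_else_; _∧_; _∨_)
open import Data.Fin using (Fin; _≟_)
open import Data.Nat.ListAction using (sum)
open import Data.List using (List; []; _∷_; _++_; [_]; length; map; concat; concatMap; zip; allFin)
open import Data.List.Relation.Unary.All using (All)
open import Data.List.Relation.Unary.Unique.Propositional using (Unique)
open import Data.List.Relation.Binary.Permutation.Propositional using (_↭_)
open import Data.Product using (_×_; _,_)
open import Data.Sum using (_⊎_)
open import Relation.Binary.PropositionalEquality using (_≡_; _≢_)
open import Relation.Nullary.Decidable using (⌊_⌋)

isOdd : ℕ → Bool
isOdd m = (m % 2) ≡ᵇ 1

-- A cycle on vertex set Fin n is a list of distinct vertices (x₀, …, x_{c-1}), c ≥ 2.
-- Its edges are {x₀,x₁}, …, {x_{c-2},x_{c-1}}, {x_{c-1},x₀}.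
-- For c = 2 this gives two parallel edges between x₀ and x₁ (a 2-cycle).
cycleEdges : {n : ℕ} → List (Fin n) → List (Fin n × Fin n)
cycleEdges [] = []
cycleEdges (x ∷ xs) = zip (x ∷ xs) (xs ++ [ x ])

edgeIs : {n : ℕ} → Fin n → Fin n → Fin n × Fin n → Bool
edgeIs u v (a , b) = (⌊ a ≟ u ⌋ ∧ ⌊ b ≟ v ⌋) ∨ (⌊ a ≟ v ⌋ ∧ ⌊ b ≟ u ⌋)

edgeCount : {n : ℕ} → Fin n → Fin n → List (Fin n × Fin n) → ℕ
edgeCount u v [] = 0
edgeCount u v (e ∷ es) = (if edgeIs u v e then 1 else 0) + edgeCount u v es

IsCycle : {n : ℕ} → List (Fin n) → Set
IsCycle c = Unique c × (2 ≤ length c)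

IsTwoFactorOfType : (n : ℕ) → List (List (Fin n)) → List ℕ → Set
IsTwoFactorOfType n F T = All IsCycle F × (map length F ≡ T) × (concat F ↭ allFin n)

IsOneFactor : (n : ℕ) → List (Fin n × Fin n) → Set
IsOneFactor n M = All (λ { (a , b) → a ≢ b }) M
                × (concatMap (λ { (a , b) → a ∷ b ∷ [] }) M ↭ allFin n)

data FactorsOfTypes (n : ℕ) : List (List (List (Fin n))) → List (List ℕ) → Set where
  []  : FactorsOfTypes n [] []
  _∷_ : ∀ {F T Fs Ts} → IsTwoFactorOfType n F T → FactorsOfTypes n Fs Ts →
        FactorsOfTypes n (F ∷ Fs) (T ∷ Ts)

totalMult : {n : ℕ} → List (List (List (Fin n))) → List (Fin n × Fin n) → Fin n → Fin n → ℕ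
totalMult Fs M u v =
  sum (map (λ F → sum (map (λ c → edgeCount u v (cycleEdges c)) F)) Fs) + edgeCount u v M

-- A 2-factorization of μK_n (which is r-regular, r = μ(n-1)) of type 𝒯 = [T₁,…,T_k]:
-- k = ⌊r/2⌋ 2-factors of types T₁,…,T_k, plus one 1-factor iff r is odd, which together
-- decompose the edge multiset of μK_n (every pair u ≠ v joined by exactly μ edges).
-- Since the 2-factors may be listed in any order, matching them pointwise to the list 𝒯
-- expresses "the multiset of their types is 𝒯".
record TwoFactorization (μ n : ℕ) (𝒯 : List (List ℕ)) : Set where
  field
    twoFactors : List (List (List (Fin n)))
    oneFactor  : List (Fin n × Fin n)
    types      : FactorsOfTypes n twoFactors 𝒯
    count      : length twoFactors ≡ (μ * (n ∸ 1)) / 2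
    oneFactorOk : (isOdd (μ * (n ∸ 1)) ≡ true × IsOneFactor n oneFactor)
                ⊎ (isOdd (μ * (n ∸ 1)) ≡ false × oneFactor ≡ [])
    decomposes : (u v : Fin n) → u ≢ v → totalMult twoFactors oneFactor u v ≡ μ

Admits : ℕ → ℕ → List (List ℕ) → Set
Admits μ n 𝒯 = TwoFactorization μ n 𝒯

AdmissibleBipartite2 : ℕ → List ℕ → Set
AdmissibleBipartite2 n T = (sum T ≡ n) × All (λ c → 2 ≤ c) T × All (λ c → isOdd c ≡ false) T

Σ[<_] : (ℓ : ℕ) → (Fin ℓ → ℕ) → ℕ
Σ[< ℓ ] f = sum (map f (allFin ℓ))

module Submission where

-- Call a list 𝒯 of 2-factor types realizable at multiplicity μ with k matchings
-- if for every choice of k perfect matchings of K_n there are 2-factors of the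
-- types 𝒯 which, together with these matchings, decompose μK_n.
--  (1) A 2-factorization of μK_n realizes its type with μ(n-1) mod 2 matchings:
--      after relabelling the vertices its own 1-factor can be replaced by any
--      other perfect matching ('rematch', 'fromFactorization').
--  (2) Realizability is additive under edge-disjoint union, so xᵢ copies of each
--      given factorization realize the union type at multiplicity Σ xᵢμᵢ = μ
--      with β = Σ_{i ∈ 𝒪} xᵢ matchings ('realizable-union').
--  (3) A 2-factor of an admissible bipartite type is the union of two perfect
--      matchings ('bipartiteSplit').  Take as the β matchings the two halves of
--      each of the ⌊β/2⌋ bipartite 2-factors T_j, plus half a Hamilton cycle if β
--      is odd, and trade every pair of halves back for its 2-factor ('absorbSplits').
--  (4) A decomposition relative to μ(n-1) mod 2 = β mod 2 matchings with
--      ⌊μ(n-1)/2⌋ 2-factors is a 2-factorization ('toFactorization').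

open import Defs
open import Data.Nat using (ℕ; zero; suc; _+_; _*_; _∸_; _/_; _%_; _≤_; _<_; z≤n; s≤s; _≡ᵇ_)
open import Data.Nat.Properties
  using (+-identityʳ; +-assoc; +-comm; *-identityʳ; *-zeroʳ; *-suc; *-assoc; *-distribˡ-+; *-distribʳ-+;
         suc-injective; 0≢1+n; m+n∸m≡n; m≤n⇒m⊓n≡m; m≤m+n; +-commutativeSemigroup)
open import Data.Nat.DivMod using (m%n<n; m≡m%n+[m/n]*n; [m+kn]%n≡m%n; +-distrib-/-∣ʳ; m*n/n≡m)
open import Data.Nat.Divisibility using (divides)
open import Algebra.Properties.CommutativeSemigroup +-commutativeSemigroup using (interchange)
open import Data.Nat.ListAction using (sum)
open import Data.Nat.ListAction.Properties using (sum-++; sum-↭)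
open import Data.Bool using (true; false; if_then_else_)
open import Data.Fin using (Fin)
import Data.Fin as Fin
open import Data.List
  using (List; []; _∷_; _++_; [_]; length; map; concat; concatMap; replicate; zip; take; drop; allFin)
import Data.List.Properties as List
open import Data.List.Relation.Unary.All using (All; []; _∷_)
import Data.List.Relation.Unary.All as All
import Data.List.Relation.Unary.All.Properties as All
open import Data.List.Relation.Unary.Any using (here; there)
open import Data.List.Relation.Unary.Unique.Propositional using (Unique; _∷_)
import Data.List.Relation.Unary.Unique.Propositional.Properties as Unique
open import Data.List.Membership.Propositional using (_∈_)
open import Data.List.Membership.Propositional.Properties using (∈-allFin)
open import Data.List.Relation.Binary.Permutation.Propositional
  using (_↭_; refl; prep; swap; trans; ↭-sym; ↭-reflexive; ↭⇒↭ₛ)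
import Data.List.Relation.Binary.Permutation.Setoid.Properties as PermSetoid
import Data.List.Relation.Binary.Permutation.Propositional.Properties as Perm
open import Data.Product using (Σ; _×_; _,_; proj₁; proj₂)
open import Data.Sum using (_⊎_; inj₁; inj₂)
open import Data.Empty using (⊥-elim)
open import Relation.Nullary using (yes; no)
open import Relation.Nullary.Decidable using (⌊_⌋)
open import Relation.Binary.Definitions using (DecidableEquality)
open import Relation.Binary.PropositionalEquality
  using (_≡_; _≢_; refl; sym; cong; cong₂; subst; subst₂; module ≡-Reasoning)
  renaming (setoid to ≡-setoid; trans to ≡-trans)

sumMap-++ : ∀ {A : Set} (g : A → ℕ) xs ys →
            sum (map g (xs ++ ys)) ≡ sum (map g xs) + sum (map g ys)
sumMap-++ g xs ys = ≡-trans (cong sum (List.map-++ g xs ys)) (sum-++ (map g xs) (map g ys))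

sumMap-↭ : ∀ {A : Set} (g : A → ℕ) {xs ys} → xs ↭ ys → sum (map g xs) ≡ sum (map g ys)
sumMap-↭ g p = sum-↭ (Perm.map⁺ g p)

hits : ∀ {n} → Fin n → Fin n → Fin n × Fin n → ℕ
hits u v e = if edgeIs u v e then 1 else 0

edgeCount-sum : ∀ {n} (u v : Fin n) es → edgeCount u v es ≡ sum (map (hits u v) es)
edgeCount-sum u v []       = refl
edgeCount-sum u v (e ∷ es) = cong (hits u v e +_) (edgeCount-sum u v es)

edgeCount-++ : ∀ {n} (u v : Fin n) xs ys →
               edgeCount u v (xs ++ ys) ≡ edgeCount u v xs + edgeCount u v ys
edgeCount-++ u v xs ys = begin
  edgeCount u v (xs ++ ys)                    ≡⟨ edgeCount-sum u v (xs ++ ys) ⟩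
  sum (map (hits u v) (xs ++ ys))             ≡⟨ sumMap-++ (hits u v) xs ys ⟩
  sum (map (hits u v) xs) + sum (map (hits u v) ys)
    ≡⟨ sym (cong₂ _+_ (edgeCount-sum u v xs) (edgeCount-sum u v ys)) ⟩
  edgeCount u v xs + edgeCount u v ys         ∎
  where open ≡-Reasoning

edgeCount-↭ : ∀ {n} (u v : Fin n) {xs ys} → xs ↭ ys → edgeCount u v xs ≡ edgeCount u v ys
edgeCount-↭ u v {xs} {ys} p = begin
  edgeCount u v xs          ≡⟨ edgeCount-sum u v xs ⟩
  sum (map (hits u v) xs)   ≡⟨ sumMap-↭ (hits u v) p ⟩
  sum (map (hits u v) ys)   ≡⟨ sym (edgeCount-sum u v ys) ⟩
  edgeCount u v ys          ∎
  where open ≡-Reasoning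

cycleMult : ∀ {n} → Fin n → Fin n → List (Fin n) → ℕ
cycleMult u v c = edgeCount u v (cycleEdges c)

twoFactorMult : ∀ {n} → Fin n → Fin n → List (List (Fin n)) → ℕ
twoFactorMult u v F = sum (map (cycleMult u v) F)

factorMult : ∀ {n} → Fin n → Fin n → List (List (List (Fin n))) → ℕ
factorMult u v Fs = sum (map (twoFactorMult u v) Fs)

matchingMult : ∀ {n} → Fin n → Fin n → List (List (Fin n × Fin n)) → ℕ
matchingMult u v Ps = sum (map (edgeCount u v) Ps)

factorsOfTypes-++ : ∀ {n Fs 𝒯 Gs 𝒰} → FactorsOfTypes n Fs 𝒯 → FactorsOfTypes n Gs 𝒰 →
                    FactorsOfTypes n (Fs ++ Gs) (𝒯 ++ 𝒰)
factorsOfTypes-++ []       q = q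
factorsOfTypes-++ (f ∷ p) q = f ∷ factorsOfTypes-++ p q

factorsOfTypes-length : ∀ {n Fs 𝒯} → FactorsOfTypes n Fs 𝒯 → length Fs ≡ length 𝒯
factorsOfTypes-length []      = refl
factorsOfTypes-length (_ ∷ p) = cong suc (factorsOfTypes-length p)

factorsOfTypes-↭ : ∀ {n Fs 𝒯 𝒰} → FactorsOfTypes n Fs 𝒯 → 𝒯 ↭ 𝒰 →
                   Σ _ λ Gs → FactorsOfTypes n Gs 𝒰 × Fs ↭ Gs
factorsOfTypes-↭ p refl = _ , p , refl
factorsOfTypes-↭ (f ∷ p) (prep _ q) with factorsOfTypes-↭ p q
... | _ , p′ , r = _ , f ∷ p′ , prep _ r
factorsOfTypes-↭ (f ∷ g ∷ p) (swap _ _ q) with factorsOfTypes-↭ p q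
... | _ , p′ , r = _ , g ∷ f ∷ p′ , swap _ _ r
factorsOfTypes-↭ p (trans q q′) with factorsOfTypes-↭ p q
... | _ , p′ , r with factorsOfTypes-↭ p′ q′
... | Hs , p″ , r′ = Hs , p″ , trans r r′

record Decomposition (μ n : ℕ) (𝒯 : List (List ℕ)) (Ps : List (List (Fin n × Fin n))) : Set where
  constructor decomposition
  field
    factors    : List (List (List (Fin n)))
    types      : FactorsOfTypes n factors 𝒯
    decomposes : ∀ u v → u ≢ v → factorMult u v factors + matchingMult u v Ps ≡ μ

decomposition-[] : ∀ {n} → Decomposition 0 n [] []
decomposition-[] = decomposition [] [] (λ _ _ _ → refl)

decomposition-++ : ∀ {μ₁ μ₂ n 𝒯₁ 𝒯₂ Ps₁ Ps₂} →
  Decomposition μ₁ n 𝒯₁ Ps₁ → Decomposition μ₂ n 𝒯₂ Ps₂ →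
  Decomposition (μ₁ + μ₂) n (𝒯₁ ++ 𝒯₂) (Ps₁ ++ Ps₂)
decomposition-++ {Ps₁ = Ps₁} {Ps₂} (decomposition F₁ t₁ d₁) (decomposition F₂ t₂ d₂) =
  decomposition (F₁ ++ F₂) (factorsOfTypes-++ t₁ t₂) λ u v u≢v → begin
    factorMult u v (F₁ ++ F₂) + matchingMult u v (Ps₁ ++ Ps₂)
      ≡⟨ cong₂ _+_ (sumMap-++ (twoFactorMult u v) F₁ F₂) (sumMap-++ (edgeCount u v) Ps₁ Ps₂) ⟩
    (factorMult u v F₁ + factorMult u v F₂) + (matchingMult u v Ps₁ + matchingMult u v Ps₂)
      ≡⟨ interchange (factorMult u v F₁) _ _ _ ⟩
    (factorMult u v F₁ + matchingMult u v Ps₁) + (factorMult u v F₂ + matchingMult u v Ps₂)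
      ≡⟨ cong₂ _+_ (d₁ u v u≢v) (d₂ u v u≢v) ⟩
    _ ∎
  where open ≡-Reasoning

decomposition-↭ : ∀ {μ n 𝒯 𝒰 Ps} → 𝒯 ↭ 𝒰 → Decomposition μ n 𝒯 Ps → Decomposition μ n 𝒰 Ps
decomposition-↭ {Ps = Ps} q (decomposition F t d) with factorsOfTypes-↭ t q
... | G , t′ , F↭G = decomposition G t′ λ u v u≢v →
  ≡-trans (cong (_+ matchingMult u v Ps) (sym (sumMap-↭ (twoFactorMult u v) F↭G))) (d u v u≢v)

endpoints : ∀ {A : Set} → List (A × A) → List A
endpoints = concatMap (λ (a , b) → a ∷ b ∷ [])

mapPair : ∀ {A : Set} → (A → A) → A × A → A × A
mapPair f (a , b) = f a , f b

endpoints-map : ∀ {A : Set} (f : A → A) M P → map f (endpoints M) ≡ endpoints P →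
                map (mapPair f) M ≡ P
endpoints-map f []      []      _ = refl
endpoints-map f (m ∷ M) (p ∷ P) e with List.∷-injective e
... | e₁ , e′ with List.∷-injective e′
... | e₂ , e″ = cong₂ _∷_ (cong₂ _,_ e₁ e₂) (endpoints-map f M P e″)

unique-↭ : ∀ {A : Set} {xs ys : List A} → xs ↭ ys → Unique xs → Unique ys
unique-↭ p = PermSetoid.Unique-resp-↭ (≡-setoid _) (↭⇒↭ₛ p)

-- Zipping two duplicate-free lists X, Y of equal length yields a renaming that
-- sends X onto Y, with the zip of Y and X as its inverse on Y.
module Renaming {A : Set} (_≟_ : DecidableEquality A) where

  rename : List (A × A) → A → A
  rename []            v = v
  rename ((a , b) ∷ z) v with a ≟ v
  ... | yes _ = b
  ... | no  _ = rename z v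

  rename-head : ∀ a b z → rename ((a , b) ∷ z) a ≡ b
  rename-head a b z with a ≟ a
  ... | yes _   = refl
  ... | no  a≢a = ⊥-elim (a≢a refl)

  rename-tail : ∀ a b z {w} → a ≢ w → rename ((a , b) ∷ z) w ≡ rename z w
  rename-tail a b z {w} a≢w with a ≟ w
  ... | yes a≡w = ⊥-elim (a≢w a≡w)
  ... | no  _   = refl

  rename-map : ∀ X Y → Unique X → length X ≡ length Y → map (rename (zip X Y)) X ≡ Y
  rename-map []      []      _          _ = refl
  rename-map (a ∷ X) (b ∷ Y) (a∉X ∷ uX) e = cong₂ _∷_ (rename-head a b (zip X Y)) (begin
    map (rename (zip (a ∷ X) (b ∷ Y))) X
      ≡⟨ List.map-cong-local (All.map (rename-tail a b (zip X Y)) a∉X) ⟩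
    map (rename (zip X Y)) X
      ≡⟨ rename-map X Y uX (suc-injective e) ⟩
    Y ∎)
    where open ≡-Reasoning

  rename-∈ : ∀ X Y {v} → length X ≡ length Y → v ∈ X → rename (zip X Y) v ∈ Y
  rename-∈ (a ∷ X) (b ∷ Y) {v} e v∈ with a ≟ v | v∈
  ... | yes _   | _         = here refl
  ... | no  a≢v | here v≡a  = ⊥-elim (a≢v (sym v≡a))
  ... | no  _   | there v∈X = there (rename-∈ X Y (suc-injective e) v∈X)

  rename-inverse : ∀ X Y {v} → Unique X → length X ≡ length Y → v ∈ Y →
                   rename (zip X Y) (rename (zip Y X) v) ≡ v
  rename-inverse (a ∷ X) (b ∷ Y) {v} (a∉X ∷ uX) e v∈ with b ≟ v | v∈
  ... | yes b≡v | _         = ≡-trans (rename-head a b (zip X Y)) b≡v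
  ... | no  b≢v | here v≡b  = ⊥-elim (b≢v (sym v≡b))
  ... | no  _   | there v∈Y = begin
    rename (zip (a ∷ X) (b ∷ Y)) (rename (zip Y X) v)
      ≡⟨ rename-tail a b (zip X Y)
           (All.lookup a∉X (rename-∈ Y X (sym (suc-injective e)) v∈Y)) ⟩
    rename (zip X Y) (rename (zip Y X) v)
      ≡⟨ rename-inverse X Y uX (suc-injective e) v∈Y ⟩
    v ∎
    where open ≡-Reasoning

module Relabel {n : ℕ} (σ τ : Fin n → Fin n)
               (τσ : ∀ x → τ (σ x) ≡ x) (στ : ∀ x → σ (τ x) ≡ x)
               (σ-permutes : map σ (allFin n) ↭ allFin n) where

  relabelFactors : List (List (List (Fin n))) → List (List (List (Fin n)))
  relabelFactors = map (map (map σ))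

  σ-injective : ∀ {x y} → σ x ≡ σ y → x ≡ y
  σ-injective {x} {y} e = ≡-trans (sym (τσ x)) (≡-trans (cong τ e) (τσ y))

  τ-injective : ∀ {x y} → τ x ≡ τ y → x ≡ y
  τ-injective {x} {y} e = ≡-trans (sym (στ x)) (≡-trans (cong σ e) (στ y))

  σ≟-τ : ∀ a u → ⌊ σ a Fin.≟ u ⌋ ≡ ⌊ a Fin.≟ τ u ⌋
  σ≟-τ a u with σ a Fin.≟ u | a Fin.≟ τ u
  ... | yes _  | yes _  = refl
  ... | no  _  | no  _  = refl
  ... | yes p  | no  ¬q = ⊥-elim (¬q (≡-trans (sym (τσ a)) (cong τ p)))
  ... | no  ¬p | yes q  = ⊥-elim (¬p (≡-trans (cong σ q) (στ u)))

  edgeCount-relabel : ∀ u v E → edgeCount u v (map (mapPair σ) E) ≡ edgeCount (τ u) (τ v) E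
  edgeCount-relabel u v []            = refl
  edgeCount-relabel u v ((a , b) ∷ E)
    rewrite σ≟-τ a u | σ≟-τ b v | σ≟-τ a v | σ≟-τ b u | edgeCount-relabel u v E = refl

  zip-relabel : ∀ xs ys → zip (map σ xs) (map σ ys) ≡ map (mapPair σ) (zip xs ys)
  zip-relabel []       _        = refl
  zip-relabel (_ ∷ _)  []       = refl
  zip-relabel (x ∷ xs) (y ∷ ys) = cong (_ ∷_) (zip-relabel xs ys)

  cycleEdges-relabel : ∀ c → cycleEdges (map σ c) ≡ map (mapPair σ) (cycleEdges c)
  cycleEdges-relabel []       = refl
  cycleEdges-relabel (x ∷ xs) =
    ≡-trans (cong (zip (σ x ∷ map σ xs)) (sym (List.map-++ σ xs [ x ])))
            (zip-relabel (x ∷ xs) (xs ++ [ x ]))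

  twoFactorMult-relabel : ∀ u v F →
    twoFactorMult u v (map (map σ) F) ≡ twoFactorMult (τ u) (τ v) F
  twoFactorMult-relabel u v []      = refl
  twoFactorMult-relabel u v (c ∷ F) = cong₂ _+_
    (≡-trans (cong (edgeCount u v) (cycleEdges-relabel c)) (edgeCount-relabel u v (cycleEdges c)))
    (twoFactorMult-relabel u v F)

  factorMult-relabel : ∀ u v Fs → factorMult u v (relabelFactors Fs) ≡ factorMult (τ u) (τ v) Fs
  factorMult-relabel u v []       = refl
  factorMult-relabel u v (F ∷ Fs) = cong₂ _+_ (twoFactorMult-relabel u v F) (factorMult-relabel u v Fs)

  matchingMult-relabel : ∀ u v Ps →
    matchingMult u v (map (map (mapPair σ)) Ps) ≡ matchingMult (τ u) (τ v) Ps
  matchingMult-relabel u v []       = refl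
  matchingMult-relabel u v (P ∷ Ps) = cong₂ _+_ (edgeCount-relabel u v P) (matchingMult-relabel u v Ps)

  twoFactor-relabel : ∀ {F T} → IsTwoFactorOfType n F T → IsTwoFactorOfType n (map (map σ) F) T
  twoFactor-relabel {F} (cycles , lengths , covers) =
    All.map⁺ (All.map (λ { {c} (uc , 2≤c) →
        Unique.map⁺ σ-injective uc , subst (2 ≤_) (sym (List.length-map σ c)) 2≤c }) cycles) ,
    ≡-trans (sym (List.map-∘ F)) (≡-trans (List.map-cong (List.length-map σ) F) lengths) ,
    subst (_↭ allFin n) (sym (List.concat-map F)) (trans (Perm.map⁺ σ covers) σ-permutes)

  factorsOfTypes-relabel : ∀ {Fs 𝒯} → FactorsOfTypes n Fs 𝒯 → FactorsOfTypes n (relabelFactors Fs) 𝒯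
  factorsOfTypes-relabel []      = []
  factorsOfTypes-relabel (f ∷ p) = twoFactor-relabel f ∷ factorsOfTypes-relabel p

  decomposition-relabel : ∀ {μ 𝒯 Ps} → Decomposition μ n 𝒯 Ps →
                          Decomposition μ n 𝒯 (map (map (mapPair σ)) Ps)
  decomposition-relabel {Ps = Ps} (decomposition F t d) =
    decomposition (relabelFactors F) (factorsOfTypes-relabel t) λ u v u≢v →
      ≡-trans (cong₂ _+_ (factorMult-relabel u v F) (matchingMult-relabel u v Ps))
              (d (τ u) (τ v) (λ e → u≢v (τ-injective e)))

-- Any perfect matching can take over the role of another one in a
-- decomposition: relabel the vertices by a bijection sending M onto P.
rematch : ∀ {μ n 𝒯 M P} → IsOneFactor n M → IsOneFactor n P →
          Decomposition μ n 𝒯 [ M ] → Decomposition μ n 𝒯 [ P ]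
rematch {n = n} {M = M} {P} (_ , M-covers) (_ , P-covers) D =
  subst (λ Q → Decomposition _ n _ [ Q ]) M↦P (decomposition-relabel D)
  where
  open Renaming Fin._≟_
  L L′ : List (Fin n)
  L  = endpoints M
  L′ = endpoints P
  uL : Unique L
  uL = unique-↭ (↭-sym M-covers) (Unique.allFin⁺ n)
  uL′ : Unique L′
  uL′ = unique-↭ (↭-sym P-covers) (Unique.allFin⁺ n)
  |L|≡|L′| : length L ≡ length L′
  |L|≡|L′| = ≡-trans (Perm.↭-length M-covers) (sym (Perm.↭-length P-covers))
  σ τ : Fin n → Fin n
  σ = rename (zip L L′)
  τ = rename (zip L′ L)
  σL≡L′ : map σ L ≡ L′
  σL≡L′ = rename-map L L′ uL |L|≡|L′|
  open Relabel σ τ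
    (λ x → rename-inverse L′ L uL′ (sym |L|≡|L′|) (Perm.∈-resp-↭ (↭-sym M-covers) (∈-allFin x)))
    (λ x → rename-inverse L L′ uL |L|≡|L′| (Perm.∈-resp-↭ (↭-sym P-covers) (∈-allFin x)))
    (trans (Perm.map⁺ σ (↭-sym M-covers)) (subst (_↭ allFin n) (sym σL≡L′) P-covers))
  M↦P : map (mapPair σ) M ≡ P
  M↦P = endpoints-map σ M P σL≡L′

Realizable : ℕ → (n : ℕ) → List (List ℕ) → ℕ → Set
Realizable μ n 𝒯 k =
  ∀ Ps → All (IsOneFactor n) Ps → length Ps ≡ k → Decomposition μ n 𝒯 Ps

oneFactorCount : ℕ → ℕ → ℕ
oneFactorCount μ n = if isOdd (μ * (n ∸ 1)) then 1 else 0

asDecomposition : ∀ {μ n 𝒯} (A : TwoFactorization μ n 𝒯) →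
                  Decomposition μ n 𝒯 [ TwoFactorization.oneFactor A ]
asDecomposition A = decomposition twoFactors types λ u v u≢v →
  ≡-trans (cong (factorMult u v twoFactors +_) (+-identityʳ (edgeCount u v oneFactor)))
          (decomposes u v u≢v)
  where open TwoFactorization A

fromFactorization : ∀ {μ n 𝒯} → Admits μ n 𝒯 → Realizable μ n 𝒯 (oneFactorCount μ n)
fromFactorization {μ} {n} {𝒯} A with TwoFactorization.oneFactorOk A
... | inj₁ (odd , M-one) = λ Ps ones |Ps| →
  withOne Ps ones (≡-trans |Ps| (cong (λ b → if b then 1 else 0) odd))
  where
  withOne : ∀ Ps → All (IsOneFactor n) Ps → length Ps ≡ 1 → Decomposition μ n 𝒯 Ps
  withOne (P ∷ []) (P-one ∷ []) _ = rematch M-one P-one (asDecomposition A)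
... | inj₂ (even , M≡[]) = λ Ps ones |Ps| →
  withNone Ps (≡-trans |Ps| (cong (λ b → if b then 1 else 0) even))
  where
  withNone : ∀ Ps → length Ps ≡ 0 → Decomposition μ n 𝒯 Ps
  withNone [] _ with decomposition F t d ← asDecomposition A rewrite M≡[] = decomposition F t d

toFactorization : ∀ {μ n 𝒯 Rs} → Decomposition μ n 𝒯 Rs → All (IsOneFactor n) Rs →
  length Rs ≡ (μ * (n ∸ 1)) % 2 → length 𝒯 ≡ (μ * (n ∸ 1)) / 2 → Admits μ n 𝒯
toFactorization {Rs = []} (decomposition F t d) [] |Rs| |𝒯| = record
  { twoFactors  = F
  ; oneFactor   = []
  ; types       = t
  ; count       = ≡-trans (factorsOfTypes-length t) |𝒯|
  ; oneFactorOk = inj₂ (sym (cong (_≡ᵇ 1) |Rs|) , refl)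
  ; decomposes  = d
  }
toFactorization {Rs = M ∷ []} (decomposition F t d) (M-one ∷ []) |Rs| |𝒯| = record
  { twoFactors  = F
  ; oneFactor   = M
  ; types       = t
  ; count       = ≡-trans (factorsOfTypes-length t) |𝒯|
  ; oneFactorOk = inj₁ (sym (cong (_≡ᵇ 1) |Rs|) , M-one)
  ; decomposes  = λ u v u≢v →
      ≡-trans (cong (factorMult u v F +_) (sym (+-identityʳ (edgeCount u v M)))) (d u v u≢v)
  }
toFactorization {μ} {n} {Rs = _ ∷ _ ∷ _} _ _ |Rs| _
  with s≤s (s≤s ()) ← subst (_< 2) (sym |Rs|) (m%n<n (μ * (n ∸ 1)) 2)

realizable-[] : ∀ {n} → Realizable 0 n [] 0
realizable-[] [] _ _ = decomposition-[]

splitAll : ∀ {A : Set} {P : A → Set} a b (xs : List A) → All P xs → length xs ≡ a + b →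
  Σ (List A) λ ys → Σ (List A) λ zs →
    xs ≡ ys ++ zs × All P ys × All P zs × length ys ≡ a × length zs ≡ b
splitAll zero    b xs       pxs       e = [] , xs , refl , [] , pxs , refl , e
splitAll (suc a) b (x ∷ xs) (px ∷ pxs) e with splitAll a b xs pxs (suc-injective e)
... | ys , zs , refl , pys , pzs , |ys| , |zs| = x ∷ ys , zs , refl , px ∷ pys , pzs , cong suc |ys| , |zs|

-- Realizability is additive: split the given matchings between the two parts.
realizable-++ : ∀ {μ₁ μ₂ n 𝒯₁ 𝒯₂ k₁ k₂} → Realizable μ₁ n 𝒯₁ k₁ → Realizable μ₂ n 𝒯₂ k₂ →
                Realizable (μ₁ + μ₂) n (𝒯₁ ++ 𝒯₂) (k₁ + k₂)
realizable-++ {k₁ = k₁} {k₂} R₁ R₂ Ps ones |Ps| with splitAll k₁ k₂ Ps ones |Ps|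
... | ys , zs , refl , ones₁ , ones₂ , |ys| , |zs| =
  decomposition-++ (R₁ ys ones₁ |ys|) (R₂ zs ones₂ |zs|)

realizable-↭ : ∀ {μ n 𝒯 𝒰 k} → 𝒯 ↭ 𝒰 → Realizable μ n 𝒯 k → Realizable μ n 𝒰 k
realizable-↭ p R Ps ones |Ps| = decomposition-↭ p (R Ps ones |Ps|)

replicateEach-zero : ∀ {A : Set} (L : List A) → concatMap (replicate 0) L ≡ []
replicateEach-zero []      = refl
replicateEach-zero (_ ∷ L) = replicateEach-zero L

replicateEach-suc : ∀ {A : Set} x (L : List A) →
                    L ++ concatMap (replicate x) L ↭ concatMap (replicate (suc x)) L
replicateEach-suc x []      = refl
replicateEach-suc x (a ∷ L) = prep a (trans (Perm.shifts L (replicate x a))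
                                            (Perm.++⁺ˡ (replicate x a) (replicateEach-suc x L)))

realizable-replicate : ∀ {μ n 𝒯 k} x → Realizable μ n 𝒯 k →
                       Realizable (x * μ) n (concatMap (replicate x) 𝒯) (x * k)
realizable-replicate {𝒯 = 𝒯} zero    R =
  realizable-↭ (↭-reflexive (sym (replicateEach-zero 𝒯))) realizable-[]
realizable-replicate {𝒯 = 𝒯} (suc x) R =
  realizable-↭ (replicateEach-suc x 𝒯) (realizable-++ R (realizable-replicate x R))

realizable-union : ∀ {I : Set} {n} (μs k : I → ℕ) (𝒯 : I → List (List ℕ)) →
  (∀ i → Realizable (μs i) n (𝒯 i) (k i)) → (x : I → ℕ) → (Is : List I) →
  Realizable (sum (map (λ i → x i * μs i) Is)) n
             (concatMap (λ i → concatMap (replicate (x i)) (𝒯 i)) Is)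
             (sum (map (λ i → x i * k i) Is))
realizable-union μs k 𝒯 R x []       = realizable-[]
realizable-union μs k 𝒯 R x (i ∷ Is) =
  realizable-++ (realizable-replicate (x i) (R i)) (realizable-union μs k 𝒯 R x Is)

-- Evenness as an inductive predicate; note that suc (suc m) % 2 reduces to m % 2.
data Even : ℕ → Set where
  even-0  : Even 0
  even-2+ : ∀ {m} → Even m → Even (suc (suc m))

Even⇒%2≡0 : ∀ {m} → Even m → m % 2 ≡ 0
Even⇒%2≡0 even-0      = refl
Even⇒%2≡0 (even-2+ e) = Even⇒%2≡0 e

isOdd≡false⇒Even : ∀ m → isOdd m ≡ false → Even m
isOdd≡false⇒Even zero          _ = even-0
isOdd≡false⇒Even (suc (suc m)) e = even-2+ (isOdd≡false⇒Even m e)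

Even-or-Even-suc : ∀ m → Even m ⊎ Even (suc m)
Even-or-Even-suc zero    = inj₁ even-0
Even-or-Even-suc (suc m) with Even-or-Even-suc m
... | inj₁ e = inj₂ (even-2+ e)
... | inj₂ e = inj₁ e

Even-+ : ∀ {a b} → Even a → Even b → Even (a + b)
Even-+ even-0      eb = eb
Even-+ (even-2+ ea) eb = even-2+ (Even-+ ea eb)

Even-*ˡ : ∀ a {m} → Even m → Even (a * m)
Even-*ˡ zero    _  = even-0
Even-*ˡ (suc a) em = Even-+ em (Even-*ˡ a em)

Distinct : ∀ {A : Set} → A × A → Set
Distinct (a , b) = a ≢ b

-- The matching {x₀x₁, x₂x₃, …} on a list (x₀, x₁, …), and the rotation
-- (x₁, …, x_{c-1}, x₀); the edges of the cycle (x₀, …, x_{c-1}) are exactly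
-- the pairs of zip c (rotate c).
consecutivePairs : ∀ {A : Set} → List A → List (A × A)
consecutivePairs (a ∷ b ∷ r) = (a , b) ∷ consecutivePairs r
consecutivePairs _           = []

rotate : ∀ {A : Set} → List A → List A
rotate []       = []
rotate (x ∷ xs) = xs ++ [ x ]

rotate-↭ : ∀ {A : Set} (c : List A) → rotate c ↭ c
rotate-↭ []       = refl
rotate-↭ (x ∷ xs) = trans (Perm.shift x xs []) (prep x (↭-reflexive (List.++-identityʳ xs)))

endpoints-consecutivePairs : ∀ {A : Set} (c : List A) → Even (length c) →
                             endpoints (consecutivePairs c) ≡ c
endpoints-consecutivePairs []          _           = refl
endpoints-consecutivePairs (a ∷ b ∷ r) (even-2+ e) =
  cong (λ t → a ∷ b ∷ t) (endpoints-consecutivePairs r e)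

consecutivePairs-distinct : ∀ {A : Set} (c : List A) → Unique c → All Distinct (consecutivePairs c)
consecutivePairs-distinct []          _                   = []
consecutivePairs-distinct (_ ∷ [])    _                   = []
consecutivePairs-distinct (a ∷ b ∷ r) ((a≢b ∷ _) ∷ _ ∷ ur) = a≢b ∷ consecutivePairs-distinct r ur

path-split : ∀ {A : Set} (b : A) w z → Even (length w) →
  zip (b ∷ w) (w ++ [ z ]) ↭ consecutivePairs w ++ consecutivePairs (b ∷ w ++ [ z ])
path-split b []          z _           = refl
path-split b (c ∷ d ∷ r) z (even-2+ e) =
  trans (prep (b , c) (prep (c , d) (path-split d r z e)))
    (trans (swap (b , c) (c , d) refl)
           (prep (c , d) (↭-sym (Perm.shift (b , c) (consecutivePairs r) _))))

cycle-split : ∀ {A : Set} (c : List A) → Even (length c) →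
              zip c (rotate c) ↭ consecutivePairs c ++ consecutivePairs (rotate c)
cycle-split []           _           = refl
cycle-split (v₀ ∷ v₁ ∷ w) (even-2+ e) = prep (v₀ , v₁) (path-split v₁ w v₀ e)

cycleEdges-rotate : ∀ {n} (c : List (Fin n)) → cycleEdges c ≡ zip c (rotate c)
cycleEdges-rotate []      = refl
cycleEdges-rotate (_ ∷ _) = refl

endpoints-concatMap : ∀ {A : Set} (f : List A → List (A × A)) (Cs : List (List A)) →
  All (λ c → endpoints (f c) ↭ c) Cs → endpoints (concatMap f Cs) ↭ concat Cs
endpoints-concatMap f []       []       = refl
endpoints-concatMap f (c ∷ Cs) (p ∷ ps) =
  subst (_↭ c ++ concat Cs) (sym (List.concatMap-++ _ (f c) (concatMap f Cs)))
        (Perm.++⁺ p (endpoints-concatMap f Cs ps))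

-- A 2-factor all of whose cycles are even is the union of two perfect
-- matchings: the consecutive pairs of its cycles and of their rotations.
module EvenFactor {n : ℕ} (F : List (List (Fin n))) (T : List ℕ)
                  (isFactor : IsTwoFactorOfType n F T) (evens : All (λ c → Even (length c)) F) where

  matchingA matchingB : List (Fin n × Fin n)
  matchingA = concatMap consecutivePairs F
  matchingB = concatMap (λ c → consecutivePairs (rotate c)) F

  private
    covers : concat F ↭ allFin n
    covers = proj₂ (proj₂ isFactor)
    uniques : All Unique F
    uniques = All.map proj₁ (proj₁ isFactor)

  isMatchingA : IsOneFactor n matchingA
  isMatchingA =
    All.concat⁺ (All.map⁺ (All.map (λ {c} uc → consecutivePairs-distinct c uc) uniques)) ,
    trans (endpoints-concatMap consecutivePairs F
             (All.map (λ {c} e → ↭-reflexive (endpoints-consecutivePairs c e)) evens))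
          covers

  isMatchingB : IsOneFactor n matchingB
  isMatchingB =
    All.concat⁺ (All.map⁺ (All.map (λ {c} uc →
      consecutivePairs-distinct (rotate c) (unique-↭ (↭-sym (rotate-↭ c)) uc)) uniques)) ,
    trans (endpoints-concatMap _ F (All.map (λ {c} e → trans
             (↭-reflexive (endpoints-consecutivePairs (rotate c)
                (subst Even (sym (Perm.↭-length (rotate-↭ c))) e)))
             (rotate-↭ c)) evens))
          covers

  splits : ∀ u v → twoFactorMult u v F ≡ edgeCount u v matchingA + edgeCount u v matchingB
  splits u v = go F evens
    where
    go : ∀ Cs → All (λ c → Even (length c)) Cs →
         twoFactorMult u v Cs ≡ edgeCount u v (concatMap consecutivePairs Cs)
                              + edgeCount u v (concatMap (λ c → consecutivePairs (rotate c)) Cs)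
    go []       []       = refl
    go (c ∷ Cs) (e ∷ es) = begin
      cycleMult u v c + twoFactorMult u v Cs
        ≡⟨ cong₂ _+_ (≡-trans (edgeCount-↭ u v (trans (↭-reflexive (cycleEdges-rotate c))
                                                       (cycle-split c e)))
                               (edgeCount-++ u v (consecutivePairs c) _))
                     (go Cs es) ⟩
      (edgeCount u v (consecutivePairs c) + edgeCount u v (consecutivePairs (rotate c)))
        + (edgeCount u v (concatMap consecutivePairs Cs)
           + edgeCount u v (concatMap (λ c → consecutivePairs (rotate c)) Cs))
        ≡⟨ interchange (edgeCount u v (consecutivePairs c)) _ _ _ ⟩
      (edgeCount u v (consecutivePairs c) + edgeCount u v (concatMap consecutivePairs Cs))
        + (edgeCount u v (consecutivePairs (rotate c))
           + edgeCount u v (concatMap (λ c → consecutivePairs (rotate c)) Cs))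
        ≡⟨ sym (cong₂ _+_ (edgeCount-++ u v (consecutivePairs c) _)
                          (edgeCount-++ u v (consecutivePairs (rotate c)) _)) ⟩
      edgeCount u v (concatMap consecutivePairs (c ∷ Cs))
        + edgeCount u v (concatMap (λ c → consecutivePairs (rotate c)) (c ∷ Cs)) ∎
      where open ≡-Reasoning

cutInto : ∀ {A : Set} → List ℕ → List A → List (List A)
cutInto []      V = []
cutInto (c ∷ T) V = take c V ∷ cutInto T (drop c V)

length-drop-sum : ∀ {A : Set} c T (V : List A) → c + sum T ≡ length V → sum T ≡ length (drop c V)
length-drop-sum c T V e =
  ≡-trans (sym (m+n∸m≡n c (sum T))) (≡-trans (cong (_∸ c) e) (sym (List.length-drop c V)))

cutInto-concat : ∀ {A : Set} T (V : List A) → sum T ≡ length V → concat (cutInto T V) ≡ V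
cutInto-concat []      []  _ = refl
cutInto-concat (c ∷ T) V e =
  ≡-trans (cong (take c V ++_) (cutInto-concat T (drop c V) (length-drop-sum c T V e)))
          (List.take++drop≡id c V)

cutInto-lengths : ∀ {A : Set} T (V : List A) → sum T ≡ length V → map length (cutInto T V) ≡ T
cutInto-lengths []      V _ = refl
cutInto-lengths (c ∷ T) V e = cong₂ _∷_
  (≡-trans (List.length-take c V) (m≤n⇒m⊓n≡m (subst (c ≤_) e (m≤m+n c (sum T)))))
  (cutInto-lengths T (drop c V) (length-drop-sum c T V e))

cutInto-unique : ∀ {A : Set} T (V : List A) → Unique V → All Unique (cutInto T V)
cutInto-unique []      V _  = []
cutInto-unique (c ∷ T) V uV = Unique.take⁺ c uV ∷ cutInto-unique T (drop c V) (Unique.drop⁺ c uV)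

All-lengths : ∀ {A : Set} {P : ℕ → Set} (Cs : List (List A)) {T} →
              map length Cs ≡ T → All P T → All (λ c → P (length c)) Cs
All-lengths Cs refl ps = All.map⁻ ps

canonicalFactor : (n : ℕ) → List ℕ → List (List (Fin n))
canonicalFactor n T = cutInto T (allFin n)

canonicalFactor-isFactor : ∀ n T → sum T ≡ n → All (2 ≤_) T →
                           IsTwoFactorOfType n (canonicalFactor n T) T
canonicalFactor-isFactor n T sumT 2≤T =
  All.zipWith (λ (u , l) → u , l)
    (cutInto-unique T (allFin n) (Unique.allFin⁺ n) , All-lengths _ lengths 2≤T) ,
  lengths ,
  ↭-reflexive (cutInto-concat T (allFin n) sumT′)
  where
  sumT′ : sum T ≡ length (allFin n)
  sumT′ = ≡-trans sumT (sym (List.length-tabulate (λ i → i)))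
  lengths : map length (canonicalFactor n T) ≡ T
  lengths = cutInto-lengths T (allFin n) sumT′

record BipartiteSplit (n : ℕ) (T : List ℕ) : Set where
  field
    factor      : List (List (Fin n))
    isFactor    : IsTwoFactorOfType n factor T
    matchingA   : List (Fin n × Fin n)
    matchingB   : List (Fin n × Fin n)
    isMatchingA : IsOneFactor n matchingA
    isMatchingB : IsOneFactor n matchingB
    splits      : ∀ u v → twoFactorMult u v factor ≡ edgeCount u v matchingA + edgeCount u v matchingB

bipartiteSplit : ∀ {n T} → AdmissibleBipartite2 n T → BipartiteSplit n T
bipartiteSplit {n} {T} (sumT , 2≤T , evenT) = record
  { factor = F ; isFactor = isFactor ; matchingA = matchingA ; matchingB = matchingB
  ; isMatchingA = isMatchingA ; isMatchingB = isMatchingB ; splits = splits }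
  where
  F : List (List (Fin n))
  F = canonicalFactor n T
  isFactor : IsTwoFactorOfType n F T
  isFactor = canonicalFactor-isFactor n T sumT 2≤T
  open EvenFactor F T isFactor
    (All-lengths F (proj₁ (proj₂ isFactor)) (All.map (λ {c} → isOdd≡false⇒Even c) evenT))

factorsOf : ∀ {n Ts} → All (BipartiteSplit n) Ts → List (List (List (Fin n)))
factorsOf []       = []
factorsOf (S ∷ Ss) = BipartiteSplit.factor S ∷ factorsOf Ss

matchingsOf : ∀ {n Ts} → All (BipartiteSplit n) Ts → List (List (Fin n × Fin n))
matchingsOf []       = []
matchingsOf (S ∷ Ss) = BipartiteSplit.matchingA S ∷ BipartiteSplit.matchingB S ∷ matchingsOf Ss

matchingsOf-oneFactors : ∀ {n Ts} (Ss : All (BipartiteSplit n) Ts) → All (IsOneFactor n) (matchingsOf Ss)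
matchingsOf-oneFactors []       = []
matchingsOf-oneFactors (S ∷ Ss) =
  BipartiteSplit.isMatchingA S ∷ BipartiteSplit.isMatchingB S ∷ matchingsOf-oneFactors Ss

matchingsOf-length : ∀ {n Ts} (Ss : All (BipartiteSplit n) Ts) → length (matchingsOf Ss) ≡ length Ts * 2
matchingsOf-length []       = refl
matchingsOf-length (S ∷ Ss) = cong (λ m → suc (suc m)) (matchingsOf-length Ss)

factorsOf-types : ∀ {n Ts} (Ss : All (BipartiteSplit n) Ts) → FactorsOfTypes n (factorsOf Ss) Ts
factorsOf-types []       = []
factorsOf-types (S ∷ Ss) = BipartiteSplit.isFactor S ∷ factorsOf-types Ss

factorsOf-mult : ∀ {n Ts} (Ss : All (BipartiteSplit n) Ts) u v →
                 factorMult u v (factorsOf Ss) ≡ matchingMult u v (matchingsOf Ss)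
factorsOf-mult []       u v = refl
factorsOf-mult (S ∷ Ss) u v =
  ≡-trans (cong₂ _+_ (BipartiteSplit.splits S u v) (factorsOf-mult Ss u v))
          (+-assoc (edgeCount u v (BipartiteSplit.matchingA S)) _ _)

absorbSplits : ∀ {μ n 𝒯 Ts Rs} (Ss : All (BipartiteSplit n) Ts) →
               Decomposition μ n 𝒯 (matchingsOf Ss ++ Rs) → Decomposition μ n (𝒯 ++ Ts) Rs
absorbSplits {Rs = Rs} Ss (decomposition F t d) =
  decomposition (F ++ factorsOf Ss) (factorsOfTypes-++ t (factorsOf-types Ss)) λ u v u≢v → begin
    factorMult u v (F ++ factorsOf Ss) + matchingMult u v Rs
      ≡⟨ cong (_+ matchingMult u v Rs) (sumMap-++ (twoFactorMult u v) F (factorsOf Ss)) ⟩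
    (factorMult u v F + factorMult u v (factorsOf Ss)) + matchingMult u v Rs
      ≡⟨ +-assoc (factorMult u v F) _ _ ⟩
    factorMult u v F + (factorMult u v (factorsOf Ss) + matchingMult u v Rs)
      ≡⟨ cong (λ m → factorMult u v F + (m + matchingMult u v Rs)) (factorsOf-mult Ss u v) ⟩
    factorMult u v F + (matchingMult u v (matchingsOf Ss) + matchingMult u v Rs)
      ≡⟨ cong (factorMult u v F +_) (sym (sumMap-++ (edgeCount u v) (matchingsOf Ss) Rs)) ⟩
    factorMult u v F + matchingMult u v (matchingsOf Ss ++ Rs)
      ≡⟨ d u v u≢v ⟩
    _ ∎
  where open ≡-Reasoning

oddDegree⇒evenOrder : ∀ μ n → (μ * (n ∸ 1)) % 2 ≡ 1 → Even n × 2 ≤ n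
oddDegree⇒evenOrder μ zero odd = ⊥-elim (0≢1+n (≡-trans (sym (Even⇒%2≡0 (Even-*ˡ μ even-0))) odd))
oddDegree⇒evenOrder μ (suc k) odd with Even-or-Even-suc k
... | inj₁ ek              = ⊥-elim (0≢1+n (≡-trans (sym (Even⇒%2≡0 (Even-*ˡ μ ek))) odd))
... | inj₂ ek@(even-2+ _)  = ek , s≤s (s≤s z≤n)

-- μ(n-1) mod 2 perfect matchings of K_n: none when μ(n-1) is even, and when it
-- is odd one half of a Hamilton cycle, [n] being an admissible bipartite type.
leftoverMatchings : ∀ μ n → Σ (List (List (Fin n × Fin n))) λ Rs →
                    All (IsOneFactor n) Rs × length Rs ≡ (μ * (n ∸ 1)) % 2
leftoverMatchings μ n with (μ * (n ∸ 1)) % 2 in r%2 | m%n<n (μ * (n ∸ 1)) 2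
... | 0           | _             = [] , [] , refl
... | 1           | _             =
  [ matchingA ] , isMatchingA ∷ [] , refl
  where
  hamiltonian : AdmissibleBipartite2 n [ n ]
  hamiltonian with en , 2≤n ← oddDegree⇒evenOrder μ n r%2 =
    +-identityʳ n , 2≤n ∷ [] , cong (_≡ᵇ 1) (Even⇒%2≡0 en) ∷ []
  open BipartiteSplit (bipartiteSplit hamiltonian)
... | suc (suc _) | s≤s (s≤s ())

%2-bit : ∀ m → m % 2 ≡ (if isOdd m then 1 else 0)
%2-bit m = bit (m%n<n m 2)
  where
  bit : ∀ {b} → b < 2 → b ≡ (if b ≡ᵇ 1 then 1 else 0)
  bit (s≤s z≤n)       = refl
  bit (s≤s (s≤s z≤n)) = refl

*-bit : ∀ x b → x * (if b then 1 else 0) ≡ (if b then x else 0)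
*-bit x true  = *-identityʳ x
*-bit x false = *-zeroʳ x

scaled-halves : ∀ x m → x * m ≡ (if isOdd m then x else 0) + x * (m / 2) * 2
scaled-halves x m = begin
  x * m                           ≡⟨ cong (x *_) (m≡m%n+[m/n]*n m 2) ⟩
  x * (m % 2 + m / 2 * 2)         ≡⟨ *-distribˡ-+ x (m % 2) _ ⟩
  x * (m % 2) + x * (m / 2 * 2)   ≡⟨ cong₂ _+_ (≡-trans (cong (x *_) (%2-bit m)) (*-bit x (isOdd m)))
                                               (sym (*-assoc x (m / 2) 2)) ⟩
  (if isOdd m then x else 0) + x * (m / 2) * 2 ∎
  where open ≡-Reasoning

degree-split : ∀ {I : Set} (x μs : I → ℕ) c Is →
  sum (map (λ i → x i * μs i) Is) * c ≡
  sum (map (λ i → if isOdd (μs i * c) then x i else 0) Is) + sum (map (λ i → x i * (μs i * c / 2)) Is) * 2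
degree-split x μs c []       = refl
degree-split x μs c (i ∷ Is) = begin
  (x i * μs i + S) * c                     ≡⟨ *-distribʳ-+ c (x i * μs i) S ⟩
  x i * μs i * c + S * c
    ≡⟨ cong₂ _+_ (≡-trans (*-assoc (x i) (μs i) c) (scaled-halves (x i) (μs i * c)))
                 (degree-split x μs c Is) ⟩
  (b + k * 2) + (B + K * 2)                ≡⟨ interchange b (k * 2) B (K * 2) ⟩
  (b + B) + (k * 2 + K * 2)                ≡⟨ cong ((b + B) +_) (sym (*-distribʳ-+ 2 k K)) ⟩
  (b + B) + (k + K) * 2                    ∎
  where
  open ≡-Reasoning
  S b B k K : ℕ
  S = sum (map (λ i → x i * μs i) Is)
  b = if isOdd (μs i * c) then x i else 0
  B = sum (map (λ i → if isOdd (μs i * c) then x i else 0) Is)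
  k = x i * (μs i * c / 2)
  K = sum (map (λ i → x i * (μs i * c / 2)) Is)

halve : ∀ {r} β K → r ≡ β + K * 2 → r % 2 ≡ β % 2 × r / 2 ≡ K + β / 2
halve β K refl =
  [m+kn]%n≡m%n β K 2 ,
  ≡-trans (+-distrib-/-∣ʳ β (divides K refl))
          (≡-trans (cong (β / 2 +_) (m*n/n≡m K 2)) (+-comm (β / 2) K))

length-halves : ∀ {A : Set} (xs ys : List A) β →
                length xs ≡ β / 2 * 2 → length ys ≡ β % 2 → length (xs ++ ys) ≡ β
length-halves xs ys β |xs| |ys| = begin
  length (xs ++ ys)         ≡⟨ List.length-++ xs ⟩
  length xs + length ys     ≡⟨ cong₂ _+_ |xs| |ys| ⟩
  β / 2 * 2 + β % 2         ≡⟨ +-comm (β / 2 * 2) (β % 2) ⟩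
  β % 2 + β / 2 * 2         ≡⟨ sym (m≡m%n+[m/n]*n β 2) ⟩
  β                         ∎
  where open ≡-Reasoning

length-replicateEach : ∀ {A : Set} x (L : List A) → length (concatMap (replicate x) L) ≡ x * length L
length-replicateEach x []      = sym (*-zeroʳ x)
length-replicateEach x (a ∷ L) = begin
  length (replicate x a ++ concatMap (replicate x) L)  ≡⟨ List.length-++ (replicate x a) ⟩
  length (replicate x a) + length (concatMap (replicate x) L)
    ≡⟨ cong₂ _+_ (List.length-replicate x) (length-replicateEach x L) ⟩
  x + x * length L                                     ≡⟨ sym (*-suc x (length L)) ⟩
  x * suc (length L)                                   ∎
  where open ≡-Reasoning

length-union : ∀ {I : Set} (x k : I → ℕ) (𝒯 : I → List (List ℕ)) → (∀ i → length (𝒯 i) ≡ k i) →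
  ∀ Is → length (concatMap (λ i → concatMap (replicate (x i)) (𝒯 i)) Is) ≡ sum (map (λ i → x i * k i) Is)
length-union x k 𝒯 |𝒯| []       = refl
length-union x k 𝒯 |𝒯| (i ∷ Is) = begin
  length (copies i ++ concatMap copies Is)          ≡⟨ List.length-++ (copies i) ⟩
  length (copies i) + length (concatMap copies Is)
    ≡⟨ cong₂ _+_ (≡-trans (length-replicateEach (x i) (𝒯 i)) (cong (x i *_) (|𝒯| i)))
                 (length-union x k 𝒯 |𝒯| Is) ⟩
  x i * k i + sum (map (λ i → x i * k i) Is)        ∎
  where
  open ≡-Reasoning
  copies : ∀ j → List (List ℕ)
  copies j = concatMap (replicate (x j)) (𝒯 j)

theorem5p3 : (n ℓ : ℕ) → 1 ≤ n → 1 ≤ ℓ →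
    (μs : Fin ℓ → ℕ) → (∀ i → 1 ≤ μs i) →
    (𝒯 : Fin ℓ → List (List ℕ)) →
    (∀ i → length (𝒯 i) ≡ (μs i * (n ∸ 1)) / 2) →
    (∀ i → Admits (μs i) n (𝒯 i)) →
    (μ : ℕ) → 1 ≤ μ →
    (x : Fin ℓ → ℕ) → Σ[< ℓ ] (λ i → x i * μs i) ≡ μ →
    (Ts : List (List ℕ)) →
    length Ts ≡ Σ[< ℓ ] (λ i → if isOdd (μs i * (n ∸ 1)) then x i else 0) / 2 →
    All (AdmissibleBipartite2 n) Ts →
    Admits μ n (concatMap (λ i → concatMap (replicate (x i)) (𝒯 i)) (allFin ℓ) ++ Ts)
theorem5p3 n ℓ _ _ μs _ 𝒯 |𝒯| admits μ _ x Σxμ≡μ Ts |Ts| bipartite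
  with Rs , Rs-ones , |Rs| ← leftoverMatchings μ n =
  toFactorization (absorbSplits Ss (R (matchingsOf Ss ++ Rs) ones |Ps|)) Rs-ones |Rs| count
  where
  Is : List (Fin ℓ)
  Is = allFin ℓ
  β K : ℕ
  β  = Σ[< ℓ ] (λ i → if isOdd (μs i * (n ∸ 1)) then x i else 0)
  K  = Σ[< ℓ ] (λ i → x i * (μs i * (n ∸ 1) / 2))
  R : Realizable μ n (concatMap (λ i → concatMap (replicate (x i)) (𝒯 i)) Is) β
  R = subst₂ (λ m k → Realizable m n _ k) Σxμ≡μ (cong sum (List.map-cong (λ i → *-bit (x i) _) Is))
        (realizable-union μs _ 𝒯 (λ i → fromFactorization (admits i)) x Is)
  -- As the β matchings take the halves of the bipartite 2-factors and the leftovers Rs.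
  Ss : All (BipartiteSplit n) Ts
  Ss = All.map bipartiteSplit bipartite
  ones : All (IsOneFactor n) (matchingsOf Ss ++ Rs)
  ones = All.++⁺ (matchingsOf-oneFactors Ss) Rs-ones
  parity : (μ * (n ∸ 1)) % 2 ≡ β % 2 × (μ * (n ∸ 1)) / 2 ≡ K + β / 2
  parity = halve β K (≡-trans (cong (_* (n ∸ 1)) (sym Σxμ≡μ)) (degree-split x μs (n ∸ 1) Is))
  |Ps| : length (matchingsOf Ss ++ Rs) ≡ β
  |Ps| = length-halves (matchingsOf Ss) Rs β
           (≡-trans (matchingsOf-length Ss) (cong (_* 2) |Ts|)) (≡-trans |Rs| (proj₁ parity))
  count : length (concatMap (λ i → concatMap (replicate (x i)) (𝒯 i)) Is ++ Ts) ≡ (μ * (n ∸ 1)) / 2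
  count = ≡-trans (List.length-++ (concatMap (λ i → concatMap (replicate (x i)) (𝒯 i)) Is))
            (≡-trans (cong₂ _+_ (length-union x _ 𝒯 |𝒯| Is) |Ts|) (sym (proj₂ parity)))
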